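{- Let $p\geq 3$, $r=\lceil\log_2(p-1)\rceil$, $m\geq 2r+2$, and let $b,c\geq 1$ be integers with $b+c\leq r+1$. Then the number of columns $v\in\{0,1,2\}^m$ for which there exist indices $i_1<\dots<i_c<j_1<\dots<j_b$ in $[m]$ such that the set of marks of $v$ is exactly $\{(i_s,j_t): s\in[c],t\in[b]\}$ (so $v$ has exactly $bc$ marks, formed by $c$ zeros above $b$ ones) and all these pairs are scarce, is at most \[2^r(r-b-c+1)+2^{b+c-2}\leq r2^r.\]
   Context: For a column $v\in\{0,1,2\}^m$, $v$ has a mark at $(x,y)$ with $x<y$ if $v_x=0$ and $v_y=1$. A pair $x<y$ of rows is scarce if $2^{m-1+x-y}<p-1$ (and abundant otherwise). -}

module Defs where

open import Data.Nat using (ℕ; _+_; _∸_; _^_; _<_)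
open import Data.Fin using (Fin; toℕ; zero; suc; _↑ˡ_; _↑ʳ_)
open import Data.Vec using (Vec; lookup)
open import Data.Product using (_×_; ∃; ∃-syntax)
open import Function.Bundles using (_⇔_)
open import Relation.Binary.PropositionalEquality using (_≡_)

Column : ℕ → Set
Column m = Vec (Fin 3) m

Mark : ∀ {m} → Column m → Fin m → Fin m → Set
Mark v x y = (toℕ x < toℕ y) × (lookup v x ≡ zero) × (lookup v y ≡ suc zero)

Scarce : ℕ → (m : ℕ) → Fin m → Fin m → Set
Scarce p m x y = 2 ^ ((m ∸ 1 + toℕ x) ∸ toℕ y) < p ∸ 1

StrictlyIncreasing : ∀ {n m} → (Fin n → Fin m) → Set
StrictlyIncreasing {n} k = ∀ (s t : Fin n) → toℕ s < toℕ t → toℕ (k s) < toℕ (k t)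

-- Combined index sequence k = (i_1 < ... < i_c < j_1 < ... < j_b):
-- i_s = k (s ↑ˡ b), j_t = k (c ↑ʳ t).
-- Good p m b c v: the marks of v are exactly {(i_s, j_t)} and all are scarce.
Good : (p m b c : ℕ) → Column m → Set
Good p m b c v =
  ∃[ k ] (StrictlyIncreasing {c + b} {m} k
    × (∀ (x y : Fin m) →
         Mark v x y ⇔ (∃[ s ] ∃[ t ] (x ≡ k (s ↑ˡ b) × y ≡ k (c ↑ʳ t))))
    × (∀ (s : Fin c) (t : Fin b) → Scarce p m (k (s ↑ˡ b)) (k (c ↑ʳ t))))

module Submission where

-- Write i for the last zero and j for the first one of the rectangle of marks. The exponent
-- m - 1 + i - j counts the rows outside the window [i, j], so scarcity of (i, j) leaves fewer than
-- r rows outside it; as m ≥ 2r, the zeros of the rectangle lie below r, its ones at or above r,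
-- and the window is all 2 inside. Reading the entries that are not 2, such a column has ones and
-- then its c zeros below r, and its b ones and then zeros from r on. Hence the support (the rows
-- that are not 2) determines the column: of two columns with the same support, the one whose zeros
-- start earlier would have c + 1 zeros below r. So a column is determined by i and the support bits
-- outside the window: with n + (b - 1) + (c - 1) such bits, n ≤ r + 1 - b - c, and n + 1 choices
-- of i, the count is at most the sum of (n + 1) 2^(n + b + c - 2), which is
-- 2^r (r + 1 - b - c) + 2^(b + c - 2).

open import Defs
open import Data.Nat using (ℕ; _+_; _*_; _∸_; _^_; _≤_)
open import Data.Nat.Logarithm using (⌈log₂_⌉)
open import Data.List using (List; length)
open import Data.List.Relation.Unary.All using (All)
open import Data.List.Relation.Unary.Unique.Propositional using (Unique)
open import Data.Product using (_×_)

open import Data.Bool using (Bool; true; false)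
open import Data.Empty using (⊥; ⊥-elim)
open import Data.Fin as Fin using (Fin; zero; suc; toℕ; fromℕ; _↑ˡ_; _↑ʳ_)
open import Data.Fin.Patterns using (0F; 1F; 2F)
open import Data.Fin.Properties as Finₚ
  using (toℕ-injective; toℕ-fromℕ; toℕ-↑ˡ; toℕ-↑ʳ; toℕ<n; ≤fromℕ; injective⇒≤)
open import Data.List as List using ([]; _∷_; _++_; map; applyUpTo)
open import Data.List.Properties using (length-++; length-map; length-applyUpTo; ∷-injectiveˡ; ∷-injectiveʳ)
open import Data.List.Membership.Propositional using (_∈_)
open import Data.List.Membership.Propositional.Properties using (∈-++⁺ˡ; ∈-++⁺ʳ; ∈-map⁺; ∈-lookup)
open import Data.List.Relation.Unary.Any as Any using (here)
open import Data.List.Relation.Unary.Any.Properties using (lookup-index)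
import Data.List.Relation.Unary.All as All
open import Data.List.Relation.Unary.AllPairs using (_∷_)
open import Data.Nat using (zero; suc; _<_; z≤n; s≤s; s≤s⁻¹; z<s; s<s; ⌈_/2⌉; _<?_; _≤?_)
open import Data.Nat.Properties
open import Data.Nat.Logarithm.Core using (⌈log2⌉)
open import Data.Nat.Induction using (<-wellFounded)
open import Data.Nat.Tactic.RingSolver using (solve-∀)
open import Data.Product as Product using (∃-syntax; Σ-syntax; _,_; _,′_; proj₁; proj₂)
open import Data.Sum using (_⊎_; inj₁; inj₂)
open import Data.Vec using ([]; _∷_; lookup)
open import Function using (_∘_)
open import Function.Bundles using (Equivalence)
open import Function.Definitions using (Injective)
open import Induction.WellFounded using (Acc; acc)
open import Relation.Binary.Core using (_Preserves_⟶_)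
open import Relation.Binary.Definitions using (tri<; tri≈; tri>)
open import Relation.Binary.PropositionalEquality
  using (_≡_; _≢_; refl; sym; trans; cong; cong₂; subst; subst₂; module ≡-Reasoning)
open import Relation.Nullary using (¬_; yes; no)

Unique⇒lookup-injective : ∀ {A : Set} {xs : List A} → Unique xs →
                          ∀ {i j} → List.lookup xs i ≡ List.lookup xs j → i ≡ j
Unique⇒lookup-injective (x∉xs ∷ u) {zero}  {zero}  _  = refl
Unique⇒lookup-injective (x∉xs ∷ u) {zero}  {suc j} eq = ⊥-elim (All.lookup x∉xs (∈-lookup j) eq)
Unique⇒lookup-injective (x∉xs ∷ u) {suc i} {zero}  eq = ⊥-elim (All.lookup x∉xs (∈-lookup i) (sym eq))
Unique⇒lookup-injective (x∉xs ∷ u) {suc i} {suc j} eq = cong suc (Unique⇒lookup-injective u eq)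

injective-code⇒length≤ : ∀ {A B : Set} {P : A → Set} (code : ∀ {a} → P a → B) →
                         (∀ {a a′} (p : P a) (p′ : P a′) → code p ≡ code p′ → a ≡ a′) →
                         ∀ {xs E} → Unique xs → All P xs → (∀ {a} (p : P a) → code p ∈ E) →
                         length xs ≤ length E
injective-code⇒length≤ code code-injective {xs} {E} unique ps code∈E = injective⇒≤ position-injective
  where
  code∈E-at : ∀ i → code (All.lookup ps (∈-lookup i)) ∈ E
  code∈E-at i = code∈E (All.lookup ps (∈-lookup i))

  position-injective : Injective _≡_ _≡_ (Any.index ∘ code∈E-at)
  position-injective {i} {j} eq = Unique⇒lookup-injective unique (code-injective _ _ (begin
    code (All.lookup ps (∈-lookup i)) ≡⟨ lookup-index (code∈E-at i) ⟩
    List.lookup E (Any.index (code∈E-at i)) ≡⟨ cong (List.lookup E) eq ⟩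
    List.lookup E (Any.index (code∈E-at j)) ≡⟨ lookup-index (code∈E-at j) ⟨
    code (All.lookup ps (∈-lookup j)) ∎))
    where open ≡-Reasoning

image⊆image⇒¬missing : ∀ {A : Set} {n} {f g : Fin n → A} → Injective _≡_ _≡_ f →
                       (∀ s → ∃[ s′ ] f s ≡ g s′) → ∀ t → ¬ (∀ s → f s ≢ g t)
image⊆image⇒¬missing {n = n} {f} {g} f-injective f⊆g t missing =
  <-irrefl refl (injective⇒≤ {f = preimage} preimage-injective)
  where
  preimage : Fin (suc n) → Fin n
  preimage zero    = t
  preimage (suc s) = proj₁ (f⊆g s)

  preimage-injective : Injective _≡_ _≡_ preimage
  preimage-injective {zero}  {zero}   _  = refl
  preimage-injective {zero}  {suc s}  eq = ⊥-elim (missing s (trans (proj₂ (f⊆g s)) (cong g (sym eq))))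
  preimage-injective {suc s} {zero}   eq = ⊥-elim (missing s (trans (proj₂ (f⊆g s)) (cong g eq)))
  preimage-injective {suc s} {suc s′} eq =
    cong suc (f-injective (trans (proj₂ (f⊆g s)) (trans (cong g eq) (sym (proj₂ (f⊆g s′))))))

++-injective : ∀ {A : Set} (xs xs′ : List A) {ys ys′} → length xs ≡ length xs′ →
               xs ++ ys ≡ xs′ ++ ys′ → xs ≡ xs′ × ys ≡ ys′
++-injective []       []         _   eq = refl , eq
++-injective (x ∷ xs) (x′ ∷ xs′) len eq =
  Product.map₁ (cong₂ _∷_ (∷-injectiveˡ eq)) (++-injective xs xs′ (suc-injective len) (∷-injectiveʳ eq))

applyUpTo-≡⇒ : ∀ {A : Set} (f g : ℕ → A) {n n′} → applyUpTo f n ≡ applyUpTo g n′ →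
               ∀ {x} → x < n → f x ≡ g x
applyUpTo-≡⇒ f g {suc n} {suc n′} eq {zero}  _          = ∷-injectiveˡ eq
applyUpTo-≡⇒ f g {suc n} {suc n′} eq {suc x} (s<s x<n) =
  applyUpTo-≡⇒ (f ∘ suc) (g ∘ suc) (∷-injectiveʳ eq) x<n

bitStrings : ℕ → List (List Bool)
bitStrings zero    = [] ∷ []
bitStrings (suc n) = map (true ∷_) (bitStrings n) ++ map (false ∷_) (bitStrings n)

length-bitStrings : ∀ n → length (bitStrings n) ≡ 2 ^ n
length-bitStrings zero    = refl
length-bitStrings (suc n) = begin
  length (map (true ∷_) (bitStrings n) ++ map (false ∷_) (bitStrings n))
    ≡⟨ length-++ (map (true ∷_) (bitStrings n)) ⟩
  length (map (true ∷_) (bitStrings n)) + length (map (false ∷_) (bitStrings n))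
    ≡⟨ cong₂ _+_ (length-map (true ∷_) (bitStrings n)) (length-map (false ∷_) (bitStrings n)) ⟩
  length (bitStrings n) + length (bitStrings n)
    ≡⟨ cong (λ k → k + k) (length-bitStrings n) ⟩
  2 ^ n + 2 ^ n
    ≡⟨ cong (2 ^ n +_) (+-identityʳ (2 ^ n)) ⟨
  2 ^ suc n ∎
  where open ≡-Reasoning

∈-bitStrings : ∀ l → l ∈ bitStrings (length l)
∈-bitStrings []          = here refl
∈-bitStrings (true ∷ l)  = ∈-++⁺ˡ (∈-map⁺ (true ∷_) (∈-bitStrings l))
∈-bitStrings (false ∷ l) =
  ∈-++⁺ʳ (map (true ∷_) (bitStrings (length l))) (∈-map⁺ (false ∷_) (∈-bitStrings l))

Code : Set
Code = ℕ × List Bool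

labelledStrings : (o k L : ℕ) → List Code
labelledStrings o zero    L = []
labelledStrings o (suc k) L = map (o + k ,′_) (bitStrings L) ++ labelledStrings o k L

length-labelledStrings : ∀ o k L → length (labelledStrings o k L) ≡ k * 2 ^ L
length-labelledStrings o zero    L = refl
length-labelledStrings o (suc k) L = begin
  length (map (o + k ,′_) (bitStrings L) ++ labelledStrings o k L)
    ≡⟨ length-++ (map (o + k ,′_) (bitStrings L)) ⟩
  length (map (o + k ,′_) (bitStrings L)) + length (labelledStrings o k L)
    ≡⟨ cong₂ _+_ (trans (length-map (o + k ,′_) (bitStrings L)) (length-bitStrings L))
                 (length-labelledStrings o k L) ⟩
  2 ^ L + k * 2 ^ L ∎
  where open ≡-Reasoning

∈-labelledStrings : ∀ o {k a L} l → a < k → length l ≡ L → (o + a , l) ∈ labelledStrings o k L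
∈-labelledStrings o {suc k} {a} l (s≤s a≤k) refl with m≤n⇒m<n∨m≡n a≤k
... | inj₁ a<k  = ∈-++⁺ʳ (map (o + k ,′_) (bitStrings (length l))) (∈-labelledStrings o l a<k refl)
... | inj₂ refl = ∈-++⁺ˡ (∈-map⁺ (o + a ,_) (∈-bitStrings l))

codeSpace : (o e N : ℕ) → List Code
codeSpace o e zero    = []
codeSpace o e (suc n) = labelledStrings o (suc n) (n + e) ++ codeSpace o e n

∈-codeSpace : ∀ o e {N n a} l → a ≤ n → n < N → length l ≡ n + e → (o + a , l) ∈ codeSpace o e N
∈-codeSpace o e {suc N} {n} l a≤n (s≤s n≤N) len with m≤n⇒m<n∨m≡n n≤N
... | inj₁ n<N  = ∈-++⁺ʳ (labelledStrings o (suc N) (N + e)) (∈-codeSpace o e l a≤n n<N len)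
... | inj₂ refl = ∈-++⁺ˡ (∈-labelledStrings o l (s≤s a≤n) len)

∈-codeSpace′ : ∀ o e′ {N i B} l → o ≤ i → e′ ≤ B → i + B < N + (o + e′) → length l ≡ i + B →
               (i , l) ∈ codeSpace o (o + e′) N
∈-codeSpace′ o e′ {N} l o≤i e′≤B i+B<N+e len with m≤n⇒∃[o]m+o≡n o≤i | m≤n⇒∃[o]m+o≡n e′≤B
... | a , refl | d , refl = ∈-codeSpace o (o + e′) l (m≤m+n a d)
  (+-cancelʳ-< (o + e′) (a + d) N (subst (_< N + (o + e′)) (regroup o a e′ d) i+B<N+e))
  (trans len (regroup o a e′ d))
  where
  regroup : ∀ o a e′ d → (o + a) + (e′ + d) ≡ (a + d) + (o + e′)
  regroup = solve-∀

length-codeSpace : ∀ o e K → length (codeSpace o e (suc K)) ≡ 2 ^ (suc K + e) * K + 2 ^ e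
length-codeSpace o e zero = begin
  length (labelledStrings o 1 e ++ [])   ≡⟨ length-++ (labelledStrings o 1 e) ⟩
  length (labelledStrings o 1 e) + 0     ≡⟨ cong (_+ 0) (length-labelledStrings o 1 e) ⟩
  1 * 2 ^ e + 0                          ≡⟨ 1*y+0≡x*0+y (2 ^ suc e) (2 ^ e) ⟩
  2 ^ suc e * 0 + 2 ^ e                  ∎
  where
  open ≡-Reasoning
  1*y+0≡x*0+y : ∀ x y → 1 * y + 0 ≡ x * 0 + y
  1*y+0≡x*0+y = solve-∀
length-codeSpace o e (suc K) = begin
  length (labelledStrings o (2 + K) (suc K + e) ++ codeSpace o e (suc K))
    ≡⟨ length-++ (labelledStrings o (2 + K) (suc K + e)) ⟩
  length (labelledStrings o (2 + K) (suc K + e)) + length (codeSpace o e (suc K))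
    ≡⟨ cong₂ _+_ (length-labelledStrings o (2 + K) (suc K + e)) (length-codeSpace o e K) ⟩
  (2 + K) * 2 ^ (suc K + e) + (2 ^ (suc K + e) * K + 2 ^ e)
    ≡⟨ regroup (2 ^ (suc K + e)) (2 ^ e) K ⟩
  2 ^ (2 + K + e) * suc K + 2 ^ e ∎
  where
  open ≡-Reasoning
  regroup : ∀ x y k → (2 + k) * x + (x * k + y) ≡ (2 * x) * suc k + y
  regroup = solve-∀

2^r*K+2^e≤r*2^r : ∀ K e → 2 ^ (suc K + e) * K + 2 ^ e ≤ (suc K + e) * 2 ^ (suc K + e)
2^r*K+2^e≤r*2^r K e = begin
  2 ^ r * K + 2 ^ e ≤⟨ +-monoʳ-≤ (2 ^ r * K) (^-monoʳ-≤ 2 (m≤n+m e (suc K))) ⟩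
  2 ^ r * K + 2 ^ r ≡⟨ x*k+x≡[1+k]*x (2 ^ r) K ⟩
  suc K * 2 ^ r     ≤⟨ *-monoˡ-≤ (2 ^ r) (m≤m+n (suc K) e) ⟩
  r * 2 ^ r         ∎
  where
  open ≤-Reasoning
  r = suc K + e
  x*k+x≡[1+k]*x : ∀ x k → x * k + x ≡ suc k * x
  x*k+x≡[1+k]*x = solve-∀

b+c≤r+1⇒∃K : ∀ {r b′ c′} → suc b′ + suc c′ ≤ r + 1 → ∃[ K ] suc K + (c′ + b′) ≡ r
b+c≤r+1⇒∃K {r} {b′} {c′} b+c≤r+1 with m≤n⇒∃[o]m+o≡n c′+b′<r
  where
  b+c≡ : ∀ b′ c′ → suc b′ + suc c′ ≡ suc (suc (c′ + b′))
  b+c≡ = solve-∀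
  c′+b′<r : c′ + b′ < r
  c′+b′<r = s≤s⁻¹ (subst₂ _≤_ (b+c≡ b′ c′) (+-comm r 1) b+c≤r+1)
... | K , eq = K , trans (cong suc (+-comm K (c′ + b′))) eq

bound≡2^r*K+2^e : ∀ K b′ c′ → let r = suc K + (c′ + b′) in
                  2 ^ r * ((r + 1) ∸ (suc b′ + suc c′)) + 2 ^ ((suc b′ + suc c′) ∸ 2)
                  ≡ 2 ^ r * K + 2 ^ (c′ + b′)
bound≡2^r*K+2^e K b′ c′ = cong₂ (λ k e → 2 ^ (suc K + (c′ + b′)) * k + 2 ^ e)
  (trans (cong (_∸ (suc b′ + suc c′)) (r+1≡ K b′ c′)) (m+n∸n≡m K (suc b′ + suc c′)))
  (trans (cong (_∸ 2) (b+c≡ b′ c′)) (m+n∸m≡n 2 (c′ + b′)))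
  where
  r+1≡ : ∀ K b′ c′ → suc K + (c′ + b′) + 1 ≡ K + (suc b′ + suc c′)
  r+1≡ = solve-∀
  b+c≡ : ∀ b′ c′ → suc b′ + suc c′ ≡ 2 + (c′ + b′)
  b+c≡ = solve-∀

n≤2^⌈log2⌉n : ∀ n (acc : Acc _<_ n) → n ≤ 2 ^ ⌈log2⌉ n acc
n≤2^⌈log2⌉n zero                _        = z≤n
n≤2^⌈log2⌉n (suc zero)          _        = s≤s z≤n
n≤2^⌈log2⌉n (suc (suc n)) (acc rs) = begin
  2 + n          ≤⟨ +-monoʳ-≤ 2 n≤h+h ⟩
  2 + (h + h)    ≡⟨ 2+[h+h]≡2*[1+h] h ⟩
  2 * suc h      ≤⟨ *-monoʳ-≤ 2 (n≤2^⌈log2⌉n (suc h) (rs (⌈n/2⌉<n n))) ⟩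
  2 * 2 ^ ⌈log2⌉ (suc h) (rs (⌈n/2⌉<n n)) ∎
  where
  open ≤-Reasoning
  h = ⌈ n /2⌉
  n≤h+h : n ≤ h + h
  n≤h+h = subst (_≤ h + h) (⌊n/2⌋+⌈n/2⌉≡n n) (+-monoˡ-≤ h (⌊n/2⌋≤⌈n/2⌉ n))
  2+[h+h]≡2*[1+h] : ∀ h → 2 + (h + h) ≡ 2 * suc h
  2+[h+h]≡2*[1+h] = solve-∀

n≤2^⌈log₂n⌉ : ∀ n → n ≤ 2 ^ ⌈log₂ n ⌉
n≤2^⌈log₂n⌉ n = n≤2^⌈log2⌉n n (<-wellFounded n)

2^-reflects-< : ∀ {a b} → 2 ^ a < 2 ^ b → a < b
2^-reflects-< 2^a<2^b = ≰⇒> λ b≤a → <⇒≱ 2^a<2^b (^-monoʳ-≤ 2 b≤a)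

module _ {n} {f : Fin (suc n) → ℕ} (f-strict : f Preserves Fin._<_ ⟶ _<_) where

  strict⇒mono : f Preserves Fin._≤_ ⟶ _≤_
  strict⇒mono {s} {t} s≤t with m≤n⇒m<n∨m≡n s≤t
  ... | inj₁ s<t = <⇒≤ (f-strict s<t)
  ... | inj₂ s≡t = ≤-reflexive (cong f (toℕ-injective s≡t))

  strict⇒injective : Injective _≡_ _≡_ f
  strict⇒injective {s} {t} eq with Finₚ.<-cmp s t
  ... | tri< s<t _ _ = ⊥-elim (<⇒≢ (f-strict s<t) eq)
  ... | tri≈ _ s≡t _ = s≡t
  ... | tri> _ _ t<s = ⊥-elim (<⇒≢ (f-strict t<s) (sym eq))

strict⇒f0+t≤ft : ∀ {n} (f : Fin (suc n) → ℕ) → f Preserves Fin._<_ ⟶ _<_ →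
                 ∀ t → f zero + toℕ t ≤ f t
strict⇒f0+t≤ft f f-strict zero = ≤-reflexive (+-identityʳ (f zero))
strict⇒f0+t≤ft {suc n} f f-strict (suc t) = begin
  f zero + suc (toℕ t) ≡⟨ +-suc (f zero) (toℕ t) ⟩
  suc (f zero) + toℕ t ≤⟨ +-monoˡ-≤ (toℕ t) (f-strict {zero} {suc zero} z<s) ⟩
  f (suc zero) + toℕ t ≤⟨ strict⇒f0+t≤ft (f ∘ suc) (f-strict ∘ s<s) t ⟩
  f (suc t)            ∎
  where open ≤-Reasoning

-- Rows at or beyond m read as 2, so they are blank and carry no mark.
entry : ∀ {m} → Column m → ℕ → Fin 3
entry []      _       = 2F
entry (a ∷ v) zero    = a
entry (a ∷ v) (suc x) = entry v x

entry-lookup : ∀ {m} (v : Column m) i → entry v (toℕ i) ≡ lookup v i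
entry-lookup (a ∷ v) zero    = refl
entry-lookup (a ∷ v) (suc i) = entry-lookup v i

entry-≥ : ∀ {m} (v : Column m) {x} → m ≤ x → entry v x ≡ 2F
entry-≥ []      _         = refl
entry-≥ (a ∷ v) (s≤s m≤x) = entry-≥ v m≤x

entry-injective : ∀ {m} {v w : Column m} → (∀ x → entry v x ≡ entry w x) → v ≡ w
entry-injective {v = []}    {[]}    _  = refl
entry-injective {v = a ∷ v} {b ∷ w} eq = cong₂ _∷_ (eq zero) (entry-injective (eq ∘ suc))

isBit : Fin 3 → Bool
isBit 0F = true
isBit 1F = true
isBit 2F = false

isBit⇒0∨1 : ∀ {a} → isBit a ≡ true → a ≡ 0F ⊎ a ≡ 1F
isBit⇒0∨1 {0F} _ = inj₁ refl
isBit⇒0∨1 {1F} _ = inj₂ refl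
isBit⇒0∨1 {2F} ()

support : ∀ {m} → Column m → ℕ → Bool
support v x = isBit (entry v x)

SameSupport : ∀ {m} → Column m → Column m → Set
SameSupport v w = ∀ x → support v x ≡ support w x

support⇒row : ∀ {m} (v : Column m) {x} → support v x ≡ true → Σ[ i ∈ Fin m ] toℕ i ≡ x
support⇒row (a ∷ v) {zero}  _    = zero , refl
support⇒row (a ∷ v) {suc x} bit = Product.map suc (cong suc) (support⇒row v bit)

-- zeroRow and oneRow are the paper's rows i₁ < … < i_c and j₁ < … < j_b, where c = suc c′, b = suc b′.
record Rectangle (r : ℕ) {m : ℕ} (b′ c′ : ℕ) (v : Column m) : Set where
  field
    zeroRow        : Fin (suc c′) → ℕ
    oneRow         : Fin (suc b′) → ℕ
    zeroRow-strict : zeroRow Preserves Fin._<_ ⟶ _<_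
    oneRow-strict  : oneRow Preserves Fin._<_ ⟶ _<_
    entry-zeroRow  : ∀ s → entry v (zeroRow s) ≡ 0F
    entry-oneRow   : ∀ t → entry v (oneRow t) ≡ 1F
    zero⇒zeroRow   : ∀ {x} → entry v x ≡ 0F → x < oneRow (fromℕ b′) → ∃[ s ] x ≡ zeroRow s
    one⇒oneRow     : ∀ {y} → entry v y ≡ 1F → zeroRow zero < y → ∃[ t ] y ≡ oneRow t
    -- Scarcity of (i_c, j₁), with the exponent m - 1 + i_c - j₁ written as i_c + (m - 1 - j₁).
    scarce         : zeroRow (fromℕ c′) + (m ∸ suc (oneRow zero)) < r

  firstZero lastZero firstOne lastOne : ℕ
  firstZero = zeroRow zero
  lastZero  = zeroRow (fromℕ c′)
  firstOne  = oneRow zero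
  lastOne   = oneRow (fromℕ b′)

scarce-exponent : ∀ {m i j} → j < m → (m ∸ 1 + i) ∸ j ≡ i + (m ∸ suc j)
scarce-exponent {suc m} {i} {j} (s≤s j≤m) = trans (+-∸-comm i j≤m) (+-comm (m ∸ j) i)

good⇒rectangle : ∀ {p m b′ c′ r} {v : Column m} → p ∸ 1 ≤ 2 ^ r →
                 Good p m (suc b′) (suc c′) v → Rectangle r b′ c′ v
good⇒rectangle {p} {m} {b′} {c′} {r} {v} p∸1≤2^r (k , k-strict , marks , scarce) = record
  { zeroRow        = zeroRow
  ; oneRow         = oneRow
  ; zeroRow-strict = λ {s} {t} s<t →
      k-strict (s ↑ˡ b) (t ↑ˡ b) (subst₂ _<_ (sym (toℕ-↑ˡ s b)) (sym (toℕ-↑ˡ t b)) s<t)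
  ; oneRow-strict  = λ {s} {t} s<t →
      k-strict (c ↑ʳ s) (c ↑ʳ t) (subst₂ _<_ (sym (toℕ-↑ʳ c s)) (sym (toℕ-↑ʳ c t)) (+-monoʳ-< c s<t))
  ; entry-zeroRow  = λ s → trans (entry-lookup v (I s)) (proj₁ (proj₂ (mark s zero)))
  ; entry-oneRow   = λ t → trans (entry-lookup v (J t)) (proj₂ (proj₂ (mark zero t)))
  ; zero⇒zeroRow   = zero⇒zeroRow
  ; one⇒oneRow     = one⇒oneRow
  ; scarce         = subst (_< r) (scarce-exponent (toℕ<n (J zero)))
                       (2^-reflects-< (<-≤-trans (scarce (fromℕ c′) zero) p∸1≤2^r))
  }
  where
  b c : ℕ
  b = suc b′
  c = suc c′

  I : Fin c → Fin m
  I s = k (s ↑ˡ b)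

  J : Fin b → Fin m
  J t = k (c ↑ʳ t)

  zeroRow : Fin c → ℕ
  zeroRow = toℕ ∘ I

  oneRow : Fin b → ℕ
  oneRow = toℕ ∘ J

  mark : ∀ s t → Mark v (I s) (J t)
  mark s t = Equivalence.from (marks (I s) (J t)) (s , t , refl , refl)

  zero⇒zeroRow : ∀ {x} → entry v x ≡ 0F → x < oneRow (fromℕ b′) → ∃[ s ] x ≡ zeroRow s
  zero⇒zeroRow {x} v[x]≡0 x<j with support⇒row v (cong isBit v[x]≡0)
  ... | i , refl with Equivalence.to (marks i (J (fromℕ b′)))
                        (x<j , trans (sym (entry-lookup v i)) v[x]≡0 , proj₂ (proj₂ (mark zero (fromℕ b′))))
  ... | s , _ , refl , _ = s , refl

  one⇒oneRow : ∀ {y} → entry v y ≡ 1F → zeroRow zero < y → ∃[ t ] y ≡ oneRow t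
  one⇒oneRow {y} v[y]≡1 i<y with support⇒row v (cong isBit v[y]≡1)
  ... | i , refl with Equivalence.to (marks (I zero) i)
                        (i<y , proj₁ (proj₂ (mark zero zero)) , trans (sym (entry-lookup v i)) v[y]≡1)
  ... | _ , t , _ , refl = t , refl

module RectangleProperties {r m b′ c′} {v : Column m} (R : Rectangle r b′ c′ v) where
  open Rectangle R

  firstZero≤zeroRow : ∀ s → firstZero ≤ zeroRow s
  firstZero≤zeroRow s = strict⇒mono zeroRow-strict {zero} {s} z≤n

  zeroRow≤lastZero : ∀ s → zeroRow s ≤ lastZero
  zeroRow≤lastZero s = strict⇒mono zeroRow-strict (≤fromℕ s)

  firstOne≤oneRow : ∀ t → firstOne ≤ oneRow t
  firstOne≤oneRow t = strict⇒mono oneRow-strict {zero} {t} z≤n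

  oneRow≤lastOne : ∀ t → oneRow t ≤ lastOne
  oneRow≤lastOne t = strict⇒mono oneRow-strict (≤fromℕ t)

  c′≤lastZero : c′ ≤ lastZero
  c′≤lastZero = ≤-trans (m≤n+m c′ firstZero) (subst (λ n → firstZero + n ≤ lastZero) (toℕ-fromℕ c′)
                                                    (strict⇒f0+t≤ft zeroRow zeroRow-strict (fromℕ c′)))

  lastOne<m : lastOne < m
  lastOne<m with support⇒row v (cong isBit (entry-oneRow (fromℕ b′)))
  ... | i , i≡lastOne = subst (_< m) i≡lastOne (toℕ<n i)

  firstOne<m : firstOne < m
  firstOne<m = ≤-<-trans (firstOne≤oneRow (fromℕ b′)) lastOne<m

  b′≤above : b′ ≤ m ∸ suc firstOne
  b′≤above = m+n≤o⇒m≤o∸n b′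
    (subst (_≤ m) (+-comm (suc firstOne) b′) (≤-trans (s≤s firstOne+b′≤lastOne) lastOne<m))
    where
    firstOne+b′≤lastOne : firstOne + b′ ≤ lastOne
    firstOne+b′≤lastOne =
      subst (λ n → firstOne + n ≤ lastOne) (toℕ-fromℕ b′) (strict⇒f0+t≤ft oneRow oneRow-strict (fromℕ b′))

  gap : ∀ {x} → lastZero < x → x < firstOne → entry v x ≡ 2F
  gap {x} lastZero<x x<firstOne with entry v x in v[x]
  ... | 0F =
    ⊥-elim (<⇒≱ lastZero<x (zero-row⇒≤ (zero⇒zeroRow v[x] (<-≤-trans x<firstOne (firstOne≤oneRow _)))))
    where
    zero-row⇒≤ : ∃[ s ] x ≡ zeroRow s → x ≤ lastZero
    zero-row⇒≤ (s , refl) = zeroRow≤lastZero s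
  ... | 1F =
    ⊥-elim (<⇒≱ x<firstOne (one-row⇒≥ (one⇒oneRow v[x] (≤-<-trans (firstZero≤zeroRow _) lastZero<x))))
    where
    one-row⇒≥ : ∃[ t ] x ≡ oneRow t → firstOne ≤ x
    one-row⇒≥ (t , refl) = firstOne≤oneRow t
  ... | 2F = refl

  zeroRow<r : ∀ s → zeroRow s < r
  zeroRow<r s = ≤-<-trans (≤-trans (zeroRow≤lastZero s) (m≤m+n lastZero _)) scarce

  module _ (r+r≤m : r + r ≤ m) where

    r≤firstOne : r ≤ firstOne
    r≤firstOne = +-cancelʳ-≤ r r firstOne (begin
      r + r                                   ≤⟨ r+r≤m ⟩
      m                                       ≤⟨ m≤n+m∸n m (suc firstOne) ⟩
      suc firstOne + (m ∸ suc firstOne)       ≡⟨ +-suc firstOne (m ∸ suc firstOne) ⟨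
      firstOne + suc (m ∸ suc firstOne)       ≤⟨ +-monoʳ-≤ firstOne (≤-trans (s≤s (m≤n+m _ lastZero)) scarce) ⟩
      firstOne + r                            ∎)
      where open ≤-Reasoning

    r≤oneRow : ∀ t → r ≤ oneRow t
    r≤oneRow t = ≤-trans r≤firstOne (firstOne≤oneRow t)

    zero-below-r : ∀ {x} → entry v x ≡ 0F → x < r → ∃[ s ] x ≡ zeroRow s
    zero-below-r v[x]≡0 x<r = zero⇒zeroRow v[x]≡0 (<-≤-trans x<r (r≤oneRow _))

    one-above-r : ∀ {y} → entry v y ≡ 1F → r ≤ y → ∃[ t ] y ≡ oneRow t
    one-above-r v[y]≡1 r≤y = one⇒oneRow v[y]≡1 (<-≤-trans (zeroRow<r zero) r≤y)

    one-below-r : ∀ {y} → entry v y ≡ 1F → y < r → y < firstZero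
    one-below-r {y} v[y]≡1 y<r with <-cmp y firstZero
    ... | tri< y<firstZero _ _ = y<firstZero
    ... | tri≈ _ refl _ = ⊥-elim (Finₚ.0≢1+n (trans (sym (entry-zeroRow zero)) v[y]≡1))
    ... | tri> _ _ firstZero<y with one⇒oneRow v[y]≡1 firstZero<y
    ...   | t , refl = ⊥-elim (<⇒≱ y<r (r≤oneRow t))

    zero-above-r : ∀ {x} → entry v x ≡ 0F → r ≤ x → lastOne < x
    zero-above-r {x} v[x]≡0 r≤x with <-cmp x lastOne
    ... | tri> _ _ lastOne<x = lastOne<x
    ... | tri≈ _ refl _ = ⊥-elim (Finₚ.0≢1+n (trans (sym v[x]≡0) (entry-oneRow (fromℕ b′))))
    ... | tri< x<lastOne _ _ with zero⇒zeroRow v[x]≡0 x<lastOne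
    ...   | s , refl = ⊥-elim (<⇒≱ (zeroRow<r s) r≤x)

module Comparison {r m b′ c′} (r+r≤m : r + r ≤ m) {v w : Column m}
                  (R : Rectangle r b′ c′ v) (T : Rectangle r b′ c′ w) where
  private
    module R = Rectangle R
    module T = Rectangle T
    module Rₚ = RectangleProperties R
    module Tₚ = RectangleProperties T

  -- Otherwise v's c′ + 1 zeros would be zeros of w below r other than w's first zero: one too many.
  firstZero-≤ : SameSupport v w → R.firstZero ≤ T.firstZero
  firstZero-≤ same = ≮⇒≥ λ T<R →
    image⊆image⇒¬missing (strict⇒injective R.zeroRow-strict) (zeroRow⊆ T<R) zero
      (λ s eq → <⇒≱ T<R (subst (R.firstZero ≤_) eq (Rₚ.firstZero≤zeroRow s)))
    where
    zeroRow⊆ : T.firstZero < R.firstZero → ∀ s → ∃[ s′ ] R.zeroRow s ≡ T.zeroRow s′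
    zeroRow⊆ T<R s with isBit⇒0∨1 (trans (sym (same (R.zeroRow s))) (cong isBit (R.entry-zeroRow s)))
    ... | inj₁ w≡0 = Tₚ.zero-below-r r+r≤m w≡0 (Rₚ.zeroRow<r s)
    ... | inj₂ w≡1 = ⊥-elim (<⇒≱ (Tₚ.one-below-r r+r≤m w≡1 (Rₚ.zeroRow<r s))
                                  (≤-trans (<⇒≤ T<R) (Rₚ.firstZero≤zeroRow s)))

  lastOne-≥ : SameSupport v w → T.lastOne ≤ R.lastOne
  lastOne-≥ same = ≮⇒≥ λ R<T →
    image⊆image⇒¬missing (strict⇒injective R.oneRow-strict) (oneRow⊆ R<T) (fromℕ b′)
      (λ t eq → <⇒≱ R<T (subst (_≤ R.lastOne) eq (Rₚ.oneRow≤lastOne t)))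
    where
    oneRow⊆ : R.lastOne < T.lastOne → ∀ t → ∃[ t′ ] R.oneRow t ≡ T.oneRow t′
    oneRow⊆ R<T t with isBit⇒0∨1 (trans (sym (same (R.oneRow t))) (cong isBit (R.entry-oneRow t)))
    ... | inj₂ w≡1 = Tₚ.one-above-r r+r≤m w≡1 (Rₚ.r≤oneRow r+r≤m t)
    ... | inj₁ w≡0 = ⊥-elim (<⇒≱ (Tₚ.zero-above-r r+r≤m w≡0 (Rₚ.r≤oneRow r+r≤m t))
                                  (≤-trans (Rₚ.oneRow≤lastOne t) (<⇒≤ R<T)))

  no-0-1-clash : R.firstZero ≡ T.firstZero → R.lastOne ≡ T.lastOne →
                 ∀ {x} → entry v x ≡ 0F → entry w x ≡ 1F → ⊥
  no-0-1-clash firstZero≡ lastOne≡ {x} v[x]≡0 w[x]≡1 with x <? r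
  ... | yes x<r with Rₚ.zero-below-r r+r≤m v[x]≡0 x<r
  ...   | s , refl = <⇒≱ (Tₚ.one-below-r r+r≤m w[x]≡1 x<r)
                         (subst (_≤ R.zeroRow s) firstZero≡ (Rₚ.firstZero≤zeroRow s))
  no-0-1-clash firstZero≡ lastOne≡ {x} v[x]≡0 w[x]≡1 | no x≮r
    with Tₚ.one-above-r r+r≤m w[x]≡1 (≮⇒≥ x≮r)
  ...   | t , refl = <⇒≱ (Rₚ.zero-above-r r+r≤m v[x]≡0 (≮⇒≥ x≮r))
                         (subst (T.oneRow t ≤_) (sym lastOne≡) (Tₚ.oneRow≤lastOne t))

support-determines : ∀ {r m b′ c′} → r + r ≤ m → {v w : Column m} →
                     Rectangle r b′ c′ v → Rectangle r b′ c′ w → SameSupport v w → v ≡ w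
support-determines r+r≤m {v} {w} R T same = entry-injective entry≡
  where
  module RT = Comparison r+r≤m R T
  module TR = Comparison r+r≤m T R

  firstZero≡ : Rectangle.firstZero R ≡ Rectangle.firstZero T
  firstZero≡ = ≤-antisym (RT.firstZero-≤ same) (TR.firstZero-≤ (sym ∘ same))

  lastOne≡ : Rectangle.lastOne R ≡ Rectangle.lastOne T
  lastOne≡ = ≤-antisym (TR.lastOne-≥ (sym ∘ same)) (RT.lastOne-≥ same)

  entry≡ : ∀ x → entry v x ≡ entry w x
  entry≡ x with entry v x in v[x] | entry w x in w[x] | same x
  ... | 0F | 0F | _ = refl
  ... | 1F | 1F | _ = refl
  ... | 2F | 2F | _ = refl
  ... | 0F | 1F | _ = ⊥-elim (RT.no-0-1-clash firstZero≡ lastOne≡ v[x] w[x])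
  ... | 1F | 0F | _ = ⊥-elim (TR.no-0-1-clash (sym firstZero≡) (sym lastOne≡) w[x] v[x])
  ... | 0F | 2F | ()
  ... | 1F | 2F | ()
  ... | 2F | 0F | ()
  ... | 2F | 1F | ()

module _ {r m b′ c′} {v : Column m} (R : Rectangle r b′ c′ v) where
  open Rectangle R

  bitsBelow bitsAbove : List Bool
  bitsBelow = applyUpTo (support v) lastZero
  bitsAbove = applyUpTo (λ y → support v (suc firstOne + y)) (m ∸ suc firstOne)

  code : Code
  code = lastZero , bitsBelow ++ bitsAbove

code-injective : ∀ {r m b′ c′} {v w : Column m} (R : Rectangle r b′ c′ v) (T : Rectangle r b′ c′ w) →
                 code R ≡ code T → SameSupport v w
code-injective {m = m} {v = v} {w} R T eq = same
  where
  module R = Rectangle R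
  module T = Rectangle T
  module Rₚ = RectangleProperties R
  module Tₚ = RectangleProperties T

  lastZero≡ : R.lastZero ≡ T.lastZero
  lastZero≡ = cong proj₁ eq

  bits≡ : bitsBelow R ≡ bitsBelow T × bitsAbove R ≡ bitsAbove T
  bits≡ = ++-injective (bitsBelow R) (bitsBelow T)
    (trans (length-applyUpTo (support v) R.lastZero)
           (trans lastZero≡ (sym (length-applyUpTo (support w) T.lastZero))))
    (cong proj₂ eq)

  firstOne≡ : R.firstOne ≡ T.firstOne
  firstOne≡ = suc-injective (∸-cancelˡ-≡ Rₚ.firstOne<m Tₚ.firstOne<m (begin
    m ∸ suc R.firstOne     ≡⟨ length-applyUpTo _ (m ∸ suc R.firstOne) ⟨
    length (bitsAbove R)   ≡⟨ cong length (proj₂ bits≡) ⟩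
    length (bitsAbove T)   ≡⟨ length-applyUpTo _ (m ∸ suc T.firstOne) ⟩
    m ∸ suc T.firstOne     ∎))
    where open ≡-Reasoning

  below : ∀ {x} → x < R.lastZero → support v x ≡ support w x
  below = applyUpTo-≡⇒ (support v) (support w) (proj₁ bits≡)

  window : ∀ {x} → R.lastZero ≤ x → x ≤ R.firstOne → support v x ≡ support w x
  window lastZero≤x x≤firstOne with m≤n⇒m<n∨m≡n lastZero≤x | m≤n⇒m<n∨m≡n x≤firstOne
  ... | inj₂ refl | _ =
    cong isBit (trans (R.entry-zeroRow _) (sym (trans (cong (entry w) lastZero≡) (T.entry-zeroRow _))))
  ... | inj₁ _ | inj₂ refl =
    cong isBit (trans (R.entry-oneRow _) (sym (trans (cong (entry w) firstOne≡) (T.entry-oneRow _))))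
  ... | inj₁ lastZero<x | inj₁ x<firstOne = cong isBit (trans (Rₚ.gap lastZero<x x<firstOne)
    (sym (Tₚ.gap (subst (_< _) lastZero≡ lastZero<x) (subst (_ <_) firstOne≡ x<firstOne))))

  above : ∀ {x} → R.firstOne < x → x < m → support v x ≡ support w x
  above {x} firstOne<x x<m = subst (λ z → support v z ≡ support w z) (m+[n∸m]≡n firstOne<x)
    (trans (applyUpTo-≡⇒ (λ y → support v (suc R.firstOne + y)) (λ y → support w (suc T.firstOne + y))
                         (proj₂ bits≡) (∸-monoˡ-< x<m firstOne<x))
           (cong (λ j → support w (suc j + (x ∸ suc R.firstOne))) (sym firstOne≡)))

  same : SameSupport v w
  same x with x <? R.lastZero
  ... | yes x<lastZero = below x<lastZero
  ... | no x≮lastZero with x ≤? R.firstOne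
  ...   | yes x≤firstOne = window (≮⇒≥ x≮lastZero) x≤firstOne
  ...   | no x≰firstOne with x <? m
  ...     | yes x<m = above (≰⇒> x≰firstOne) x<m
  ...     | no x≮m = cong isBit (trans (entry-≥ v (≮⇒≥ x≮m)) (sym (entry-≥ w (≮⇒≥ x≮m))))

code∈codeSpace : ∀ {K m b′ c′} {v : Column m} (R : Rectangle (suc K + (c′ + b′)) b′ c′ v) →
                 code R ∈ codeSpace c′ (c′ + b′) (suc K)
code∈codeSpace {K} {m} {b′} {c′} {v} R =
  ∈-codeSpace′ c′ b′ {suc K} (bitsBelow R ++ bitsAbove R) Rₚ.c′≤lastZero Rₚ.b′≤above R.scarce (begin
    length (bitsBelow R ++ bitsAbove R)           ≡⟨ length-++ (bitsBelow R) ⟩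
    length (bitsBelow R) + length (bitsAbove R)   ≡⟨ cong₂ _+_ (length-applyUpTo _ R.lastZero)
                                                               (length-applyUpTo _ (m ∸ suc R.firstOne)) ⟩
    R.lastZero + (m ∸ suc R.firstOne)             ∎)
  where
  module R = Rectangle R
  module Rₚ = RectangleProperties R
  open ≡-Reasoning

lemma5 : (p m b c : ℕ) → 3 ≤ p → 2 * ⌈log₂ (p ∸ 1)⌉ + 2 ≤ m
    → 1 ≤ b → 1 ≤ c → b + c ≤ ⌈log₂ (p ∸ 1)⌉ + 1
    → (vs : List (Column m)) → Unique vs → All (Good p m b c) vs
    → (length vs ≤ 2 ^ ⌈log₂ (p ∸ 1)⌉ * ((⌈log₂ (p ∸ 1)⌉ + 1) ∸ (b + c)) + 2 ^ ((b + c) ∸ 2))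
    × (2 ^ ⌈log₂ (p ∸ 1)⌉ * ((⌈log₂ (p ∸ 1)⌉ + 1) ∸ (b + c)) + 2 ^ ((b + c) ∸ 2) ≤ ⌈log₂ (p ∸ 1)⌉ * 2 ^ ⌈log₂ (p ∸ 1)⌉)
lemma5 p m (suc b′) (suc c′) _ 2r+2≤m (s≤s z≤n) (s≤s z≤n) b+c≤r+1 vs unique good
  with ⌈log₂ (p ∸ 1)⌉ | n≤2^⌈log₂n⌉ (p ∸ 1)
... | r | p∸1≤2^r with b+c≤r+1⇒∃K b+c≤r+1
... | K , refl rewrite bound≡2^r*K+2^e K b′ c′ =
  ≤-trans count (≤-reflexive (length-codeSpace c′ (c′ + b′) K)) , 2^r*K+2^e≤r*2^r K (c′ + b′)
  where
  r+r≤m : r + r ≤ m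
  r+r≤m = ≤-trans (≤-reflexive (cong (r +_) (sym (+-identityʳ r)))) (≤-trans (m≤m+n (2 * r) 2) 2r+2≤m)

  count : length vs ≤ length (codeSpace c′ (c′ + b′) (suc K))
  count = injective-code⇒length≤ code (λ R T → support-determines r+r≤m R T ∘ code-injective R T)
            unique (All.map (good⇒rectangle {p} p∸1≤2^r) good) (code∈codeSpace {K})
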